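{- Let $k>0$ be an integer, let $D$ be a digraph of diameter $2$ or a bipartite digraph of diameter $3$, and let $H$ be a sub-digraph of $D$ whose maximum out-degree is at most $k$. Consider the game of Cops and Robbers in which the robber is restricted to positions and moves in $H$ (he chooses his initial vertex in $H$ and may only stay or move along arcs of $H$), while the cops move on $D$ as usual. Then $k+1$ cops can catch the robber.
   Context: A digraph has diameter $2$ if for any two vertices $u,v$ there is a directed path from $u$ to $v$ of length at most $2$; a bipartite digraph (vertex set partitioned into two parts with every arc joining the two parts) has diameter $3$ if for any two vertices $u,v$ there is a directed path from $u$ to $v$ of length at most $3$. Cops and Robbers on a digraph: cops choose initial vertices, then the robber; then alternately (cops first) each cop stays or moves along an arc to an out-neighbour, and the robber stays or moves along an arc to an out-neighbour. The robber is caught when, after a cops' move, a cop occupies his vertex. -}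

module Defs where

open import Data.Nat using (ℕ; zero; suc; _≤_; _<_)
open import Data.Fin using (Fin)
open import Data.Bool using (Bool; true; false; T; if_then_else_)
open import Data.List using (List; map; allFin)
open import Data.Nat.ListAction using (sum)
open import Data.Product using (Σ; ∃; _×_; _,_)
open import Data.Sum using (_⊎_)
open import Relation.Binary.PropositionalEquality using (_≡_; _≢_)

record Digraph (n : ℕ) : Set where
  field
    arc      : Fin n → Fin n → Bool
    loopless : ∀ v → arc v v ≡ false
open Digraph public

_⟶[_]_ : {n : ℕ} → Fin n → Digraph n → Fin n → Set
u ⟶[ D ] v = T (arc D u v)

Diameter2 : {n : ℕ} → Digraph n → Set
Diameter2 {n} D = ∀ (u v : Fin n) →
  (u ≡ v) ⊎ (u ⟶[ D ] v) ⊎ (∃ λ w → (u ⟶[ D ] w) × (w ⟶[ D ] v))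

Bipartite : {n : ℕ} → Digraph n → Set
Bipartite {n} D = Σ (Fin n → Bool) λ side →
  ∀ (u v : Fin n) → u ⟶[ D ] v → side u ≢ side v

Diameter3 : {n : ℕ} → Digraph n → Set
Diameter3 {n} D = ∀ (u v : Fin n) →
  (u ≡ v) ⊎ (u ⟶[ D ] v)
  ⊎ (∃ λ w → (u ⟶[ D ] w) × (w ⟶[ D ] v))
  ⊎ (∃ λ w → ∃ λ x → (u ⟶[ D ] w) × (w ⟶[ D ] x) × (x ⟶[ D ] v))

record SubDigraph {n : ℕ} (D : Digraph n) : Set where
  field
    inV    : Fin n → Bool
    subArc : Fin n → Fin n → Bool
    arc⊆   : ∀ u v → T (subArc u v) → u ⟶[ D ] v
    src∈   : ∀ u v → T (subArc u v) → T (inV u)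
    tgt∈   : ∀ u v → T (subArc u v) → T (inV v)
open SubDigraph public

outDeg : {n : ℕ} {D : Digraph n} → SubDigraph D → Fin n → ℕ
outDeg {n} H v = sum (map (λ w → if subArc H v w then 1 else 0) (allFin n))

MaxOutDeg≤ : {n : ℕ} {D : Digraph n} → SubDigraph D → ℕ → Set
MaxOutDeg≤ {n} H k = ∀ (v : Fin n) → T (inV H v) → outDeg H v ≤ k

Cops : ℕ → ℕ → Set
Cops c n = Fin c → Fin n

CopMove : {n c : ℕ} → Digraph n → Cops c n → Cops c n → Set
CopMove D cs cs' = ∀ i → (cs' i ≡ cs i) ⊎ (cs i ⟶[ D ] cs' i)

RobberMove : {n : ℕ} {D : Digraph n} → SubDigraph D → Fin n → Fin n → Set
RobberMove H r r' = (r' ≡ r) ⊎ T (subArc H r r')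

-- CopsWin D H cs r : in the position where the cops (at cs) are to move
-- and the robber is at r, the cops have a strategy that surely catches
-- the robber in finitely many rounds (inductive attractor of the
-- finite game).
data CopsWin {n c : ℕ} (D : Digraph n) (H : SubDigraph D)
             (cs : Cops c n) (r : Fin n) : Set where
  catch : (cs' : Cops c n) → CopMove D cs cs' →
          (∃ λ i → cs' i ≡ r) → CopsWin D H cs r
  step  : (cs' : Cops c n) → CopMove D cs cs' →
          (∀ r' → RobberMove H r r' → CopsWin D H cs' r') →
          CopsWin D H cs r

CopsCatchOn : {n : ℕ} (D : Digraph n) → SubDigraph D → ℕ → Set
CopsCatchOn {n} D H c = Σ (Cops c n) λ cs →
  ∀ (r : Fin n) → T (inV H r) → CopsWin D H cs r

module Submission where

-- The whole argument rests on one round of play.  Call the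
-- robber's possible next vertices (r itself and its out-neighbours in H)
-- his escape set; it has at most k + 1 elements.  If the k + 1 cops can be
-- matched to targets covering the escape set, each cop within distance 2
-- of its target, then every cop walks half way, the robber picks an
-- escape vertex, and the cop assigned to it completes the walk onto him
-- (`coverWins`, with the matching built from an enumeration of the
-- out-neighbours in `neighbourhoodWins`).
--   * Diameter 2: all cops start on one vertex; everything is within
--     distance 2, so the robber is caught in the first round.
--   * Bipartite of diameter 3: vertices on a common side are within
--     distance 2.  A cop on the robber's side either strikes at once or
--     steps to distance 1, the others moving to the robber's side; the
--     robber must then move (`threaten`), after which the set-up of
--     `neighbourhoodWins` holds (`sameSideWins`).  Starting with cop 0 at
--     a and the others at an out-neighbour b of a, some cop is on the
--     robber's side, and one threatening move puts cop 0 on it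
--     (`oppositeSidesWin`).

open import Defs
open import Data.Nat using (ℕ; zero; suc; _<_; _≤_; s≤s)
open import Data.Sum using (_⊎_; inj₁; inj₂)
open import Data.Product using (_×_; Σ; ∃; _,_; proj₁; proj₂)
open import Data.Fin using (Fin; zero; suc)
open import Data.Fin.Properties using () renaming (_≟_ to _≟ᶠ_)
open import Data.Bool using (Bool; true; false; T; if_then_else_)
open import Data.Bool.Properties using (¬-not) renaming (_≟_ to _≟ᵇ_)
open import Data.Unit using (tt)
open import Data.Empty using (⊥-elim)
open import Data.Maybe using (Maybe; just; nothing; fromMaybe)
open import Data.Maybe.Properties using (just-injective)
open import Data.List using (List; []; _∷_; map; allFin)
open import Data.Nat.ListAction using (sum)
open import Data.List.Relation.Unary.Any using (here; there)
open import Data.List.Membership.Propositional using (_∈_)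
open import Data.List.Membership.Propositional.Properties using (∈-allFin)
open import Data.Vec.Functional using (updateAt)
open import Data.Vec.Functional.Properties using (updateAt-updates; updateAt-minimal)
open import Function using (const)
open import Relation.Binary.PropositionalEquality
  using (_≡_; _≢_; refl; sym; trans; cong; subst)
open import Relation.Nullary using (yes; no)

enumerate : {A : Set} (b : A → Bool) (xs : List A) (k : ℕ) →
  sum (map (λ x → if b x then 1 else 0) xs) ≤ k →
  Σ (Fin k → Maybe A) λ g →
    (∀ j x → g j ≡ just x → T (b x)) ×
    (∀ x → x ∈ xs → T (b x) → ∃ λ j → g j ≡ just x)
enumerate b [] k _ = (λ _ → nothing) , (λ _ _ ()) , (λ _ ())
enumerate b (y ∷ ys) k bound with b y in by
enumerate b (y ∷ ys) (suc k) (s≤s bound) | true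
  with g , sound , complete ← enumerate b ys k bound
  = g′ , sound′ , complete′
  where
  g′ : Fin (suc k) → Maybe _
  g′ zero    = just y
  g′ (suc j) = g j
  sound′ : ∀ j x → g′ j ≡ just x → T (b x)
  sound′ zero    x e = subst (λ z → T (b z)) (just-injective e) (subst T (sym by) tt)
  sound′ (suc j) x e = sound j x e
  complete′ : ∀ x → x ∈ y ∷ ys → T (b x) → ∃ λ j → g′ j ≡ just x
  complete′ x (here refl) _ = zero , refl
  complete′ x (there x∈ys) bx with j , e ← complete x x∈ys bx = suc j , e
enumerate b (y ∷ ys) k bound | false
  with g , sound , complete ← enumerate b ys k bound
  = g , sound , complete′
  where
  complete′ : ∀ x → x ∈ y ∷ ys → T (b x) → ∃ λ j → g j ≡ just x
  complete′ x (here refl) bx = ⊥-elim (subst T by bx)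
  complete′ x (there x∈ys) bx = complete x x∈ys bx

sameColour : {a b c : Bool} → a ≢ b → b ≢ c → a ≡ c
sameColour a≢b b≢c = trans (¬-not a≢b) (sym (¬-not (λ c≡b → b≢c (sym c≡b))))

module Game {n : ℕ} (D : Digraph n) (H : SubDigraph D) where

  Step : Fin n → Fin n → Set
  Step p q = (q ≡ p) ⊎ (p ⟶[ D ] q)

  Within2 : Fin n → Fin n → Set
  Within2 p t = (p ≡ t) ⊎ (p ⟶[ D ] t) ⊎ (∃ λ w → (p ⟶[ D ] w) × (w ⟶[ D ] t))

  halfway : ∀ {p t} → Within2 p t → Σ (Fin n) λ q → Step p q × Step q t
  halfway {p} (inj₁ p≡t)              = p , inj₁ refl , inj₁ (sym p≡t)
  halfway {p} (inj₂ (inj₁ p⟶t))       = p , inj₁ refl , inj₂ p⟶t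
  halfway     (inj₂ (inj₂ (w , p⟶w , w⟶t))) = w , inj₂ p⟶w , inj₂ w⟶t

  strike : ∀ {c} (cs : Cops c n) {r} i → Step (cs i) r → CopsWin D H cs r
  strike cs {r} i s = catch (updateAt cs i (const r)) move (i , updateAt-updates i cs)
    where
    move : CopMove D cs (updateAt cs i (const r))
    move j with j ≟ᶠ i
    ... | yes refl rewrite updateAt-updates i {const r} cs = s
    ... | no j≢i = inj₁ (updateAt-minimal j i cs j≢i)

  -- If after a cops' move some cop is one move from the robber, the robber
  -- cannot stay; so it suffices to win against each move along an arc of H.
  threaten : ∀ {c} {cs cs' : Cops c n} {r} → CopMove D cs cs' → (i : Fin c) →
    Step (cs' i) r → (∀ r' → T (subArc H r r') → CopsWin D H cs' r') →
    CopsWin D H cs r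
  threaten {cs' = cs'} move i s cont = step cs' move λ
    { _  (inj₁ refl) → strike cs' i s
    ; r' (inj₂ r⟶r') → cont r' r⟶r' }

  -- One-round win: cops within distance 2 of targets covering the
  -- robber's escape set walk half way, then the right cop finishes.
  coverWins : ∀ {c} (cs : Cops c n) r (τ : Fin c → Fin n) →
    (∀ i → Within2 (cs i) (τ i)) →
    (∀ r' → RobberMove H r r' → ∃ λ i → τ i ≡ r') →
    CopsWin D H cs r
  coverWins cs r τ near cover =
    step (λ i → proj₁ (halfway (near i))) (λ i → proj₁ (proj₂ (halfway (near i))))
      λ r' move → catch τ (λ i → proj₂ (proj₂ (halfway (near i)))) (cover r' move)

  neighbourhoodWins : ∀ k → MaxOutDeg≤ H k → ∀ (cs : Cops (suc k) n) r →
    T (inV H r) → Within2 (cs zero) r →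
    (∀ j x → T (subArc H r x) → Within2 (cs (suc j)) x) →
    CopsWin D H cs r
  neighbourhoodWins k deg cs r r∈H near₀ nearOut = coverWins cs r τ near cover
    where
    listing = enumerate (subArc H r) (allFin n) k (deg r r∈H)
    g = proj₁ listing

    τ : Fin (suc k) → Fin n
    τ zero    = r
    τ (suc j) = fromMaybe (cs (suc j)) (g j)

    near : ∀ i → Within2 (cs i) (τ i)
    near zero = near₀
    near (suc j) with g j in gj
    ... | nothing = inj₁ refl
    ... | just x  = nearOut j x (proj₁ (proj₂ listing) j x gj)

    cover : ∀ r' → RobberMove H r r' → ∃ λ i → τ i ≡ r'
    cover r' (inj₁ r'≡r) = zero , sym r'≡r
    cover r' (inj₂ r⟶r')
      with j , gj ← proj₂ (proj₂ listing) r' (∈-allFin r') r⟶r'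
      = suc j , cong (fromMaybe (cs (suc j))) gj

  placement : ∀ {c} → Fin n → Fin n → Cops (suc c) n
  placement a b zero    = a
  placement a b (suc _) = b

  module Sides (σ : Fin n → Bool) (bip : ∀ u v → u ⟶[ D ] v → σ u ≢ σ v)
                   (diam : Diameter3 D) where

    -- Vertices of the same colour are within distance 2 (paths of length
    -- 3 change colour).
    sameSideWithin2 : ∀ u v → σ u ≡ σ v → Within2 u v
    sameSideWithin2 u v σu≡σv with diam u v
    ... | inj₁ u≡v               = inj₁ u≡v
    ... | inj₂ (inj₁ u⟶v)        = inj₂ (inj₁ u⟶v)
    ... | inj₂ (inj₂ (inj₁ path)) = inj₂ (inj₂ path)
    ... | inj₂ (inj₂ (inj₂ (w , x , u⟶w , w⟶x , x⟶v))) =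
      ⊥-elim (bip x v x⟶v (trans (sym (sameColour (bip u w u⟶w) (bip w x w⟶x))) σu≡σv))

    outNeighbour : ∀ p v → p ≢ v → ∃ λ q → p ⟶[ D ] q
    outNeighbour p v p≢v with diam p v
    ... | inj₁ p≡v                          = ⊥-elim (p≢v p≡v)
    ... | inj₂ (inj₁ p⟶v)                   = v , p⟶v
    ... | inj₂ (inj₂ (inj₁ (w , p⟶w , _)))   = w , p⟶w
    ... | inj₂ (inj₂ (inj₂ (w , _ , p⟶w , _))) = w , p⟶w

    moveToSide : (v p : Fin n) → Σ (Fin n) λ q → Step p q × (σ q ≡ σ v)
    moveToSide v p with σ p ≟ᵇ σ v
    ... | yes σp≡σv = p , inj₁ refl , σp≡σv
    ... | no σp≢σv with q , p⟶q ← outNeighbour p v (λ p≡v → σp≢σv (cong σ p≡v)) =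
      q , inj₂ p⟶q , sym (sameColour (λ e → σp≢σv (sym e)) (bip p q p⟶q))

    flips : ∀ {r r'} → T (subArc H r r') → σ r ≢ σ r'
    flips {r} {r'} r⟶r' = bip r r' (arc⊆ H r r' r⟶r')

    -- k + 1 cops win once cop 0 is on the robber's side: it strikes or
    -- steps next to the robber while the others move to the robber's
    -- side; when the robber moves, `neighbourhoodWins` applies.
    sameSideWins : ∀ k → MaxOutDeg≤ H k → ∀ (cs : Cops (suc k) n) r →
      T (inV H r) → σ (cs zero) ≡ σ r → CopsWin D H cs r
    sameSideWins k deg cs r r∈H same with sameSideWithin2 (cs zero) r same
    ... | inj₁ c≡r        = strike cs zero (inj₁ (sym c≡r))
    ... | inj₂ (inj₁ c⟶r) = strike cs zero (inj₂ c⟶r)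
    ... | inj₂ (inj₂ (w , c⟶w , w⟶r)) = threaten move zero (inj₂ w⟶r) respond
      where
      aligned : ∀ j → Σ (Fin n) λ q → Step (cs (suc j)) q × (σ q ≡ σ r)
      aligned j = moveToSide r (cs (suc j))

      cs' : Cops (suc k) n
      cs' zero    = w
      cs' (suc j) = proj₁ (aligned j)

      move : CopMove D cs cs'
      move zero    = inj₂ c⟶w
      move (suc j) = proj₁ (proj₂ (aligned j))

      respond : ∀ r' → T (subArc H r r') → CopsWin D H cs' r'
      respond r' r⟶r' = neighbourhoodWins k deg cs' r' (tgt∈ H r r' r⟶r')
        (sameSideWithin2 w r' (sameColour (bip w r w⟶r) (flips r⟶r')))
        λ j x r'⟶x → sameSideWithin2 (cs' (suc j)) x
          (trans (proj₂ (proj₂ (aligned j))) (sameColour (flips r⟶r') (flips r'⟶x)))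

    -- From cop 0 at a and the others at an out-neighbour b of a: if cop 0
    -- is off the robber's side, cop 1 is on it and threatens, forcing the
    -- robber onto cop 0's side.
    oppositeSidesWin : ∀ k → MaxOutDeg≤ H (suc k) → ∀ a b → a ⟶[ D ] b →
      ∀ r → T (inV H r) → CopsWin D H (placement a b) r
    oppositeSidesWin k deg a b a⟶b r r∈H with σ a ≟ᵇ σ r
    ... | yes σa≡σr = sameSideWins (suc k) deg _ r r∈H σa≡σr
    ... | no σa≢σr
      with sameSideWithin2 b r (sym (sameColour (λ e → σa≢σr (sym e)) (bip a b a⟶b)))
    ...   | inj₁ b≡r        = strike (placement a b) (suc zero) (inj₁ (sym b≡r))
    ...   | inj₂ (inj₁ b⟶r) = strike (placement a b) (suc zero) (inj₂ b⟶r)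
    ...   | inj₂ (inj₂ (w , b⟶w , w⟶r)) = threaten move (suc zero) (inj₂ w⟶r)
      λ r' r⟶r' → sameSideWins (suc k) deg (placement a w) r' (tgt∈ H r r' r⟶r')
        (sameColour σa≢σr (flips r⟶r'))
      where
      move : CopMove D (placement a b) (placement a w)
      move zero    = inj₁ refl
      move (suc _) = inj₂ b⟶w

diameter2Catch : ∀ k {n} → 0 < n → (D : Digraph n) → Diameter2 D →
  (H : SubDigraph D) → MaxOutDeg≤ H k → CopsCatchOn D H (suc k)
diameter2Catch k {suc _} _ D diam H deg =
  (λ _ → zero) , λ r r∈H → Game.neighbourhoodWins D H k deg (λ _ → zero) r r∈H
    (diam zero r) (λ _ x _ → diam zero x)

bipartiteCatch : ∀ k {n} → 0 < n → (D : Digraph n) → Bipartite D → Diameter3 D →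
  (H : SubDigraph D) → MaxOutDeg≤ H (suc k) → CopsCatchOn D H (suc (suc k))
bipartiteCatch k {suc zero} _ D _ _ H _ =
  (λ _ → zero) , λ { zero _ → Game.strike D H (λ _ → zero) zero (inj₁ refl) }
bipartiteCatch k {suc (suc _)} _ D (σ , bip) diam H deg
  with b , 0⟶b ← Game.Sides.outNeighbour D H σ bip diam zero (suc zero) (λ ())
  = placement zero b , oppositeSidesWin k deg zero b 0⟶b
  where
  open Game D H
  open Sides σ bip diam

lemma11 : (k n : ℕ) → 0 < k → 0 < n → (D : Digraph n) →
    (Diameter2 D ⊎ (Bipartite D × Diameter3 D)) →
    (H : SubDigraph D) → MaxOutDeg≤ H k →
    CopsCatchOn D H (suc k)
lemma11 k       n _       n>0 D (inj₁ diam)         H deg = diameter2Catch k n>0 D diam H deg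
lemma11 (suc k) n _       n>0 D (inj₂ (bip , diam)) H deg = bipartiteCatch k n>0 D bip diam H deg
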